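{- Let $s\ge 2$ and $1\le l<s$ be integers, $n=2s-l$, and let $\mathcal F\subset 2^{[n]}$ satisfy $\nu(\mathcal F)<s$. Then $|2^{[n]}\setminus\mathcal F|\ge 2(s-l)+2$.
   Context: Members $F_1,\dots,F_s$ of $\mathcal F$ are pairwise disjoint if $F_i\cap F_j=\emptyset$ for $i\neq j$ (they may coincide only if empty, so $\emptyset\in\mathcal F$ forces $\nu(\mathcal F)=\infty$); $\nu(\mathcal F)$ is the maximum number of pairwise disjoint members of $\mathcal F$. -}

module Defs where

open import Data.Nat using (ℕ; zero; suc)
open import Data.Bool using (Bool; true; false; not)
open import Data.List using (List; []; _∷_; _++_; map; length; filterᵇ)
open import Data.Vec using (Vec; []; _∷_)
open import Data.Fin using (Fin)
open import Data.Fin.Subset using (Subset; outside; inside; _∩_; Empty)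
open import Data.Product using (Σ; _×_)
open import Relation.Binary.PropositionalEquality using (_≡_; _≢_)
open import Relation.Nullary using (¬_)

Family : ℕ → Set
Family n = Subset n → Bool

allSubsets : (n : ℕ) → List (Subset n)
allSubsets zero = [] ∷ []
allSubsets (suc n) = map (outside ∷_) (allSubsets n) ++ map (inside ∷_) (allSubsets n)

complementSize : {n : ℕ} → Family n → ℕ
complementSize {n} 𝓕 = length (filterᵇ (λ A → not (𝓕 A)) (allSubsets n))

-- s pairwise disjoint members F_1,…,F_s of 𝓕 (indices distinct; sets may coincide only if empty)
HasDisjointMembers : {n : ℕ} → Family n → ℕ → Set
HasDisjointMembers {n} 𝓕 s =
  Σ (Fin s → Subset n) λ G → ((i : Fin s) → 𝓕 (G i) ≡ true) × ((i j : Fin s) → i ≢ j → Empty (G i ∩ G j))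

νLess : {n : ℕ} → Family n → ℕ → Set
νLess 𝓕 s = ¬ HasDisjointMembers 𝓕 s

-- Induct on |U| = s + t for a ground set U ⊆ [n] containing no s pairwise disjoint members
-- of 𝓕, producing 2t + 2 distinct subsets of U outside 𝓕.  If some {x} ∈ 𝓕, pass to U - x,
-- where fewer than s - 1 disjoint members fit.  Otherwise pick x ≠ y in U: if {x,y} ∈ 𝓕, pass
-- to U - x - y (with s - 1, t - 1) and collect {x}, {y}; if {x,y} ∉ 𝓕, pass to U - x (with s,
-- t - 1) and collect {x}, {x,y}.  When t = 0 the two missing sets are ∅ (s copies of ∅ would
-- be disjoint) and a singleton.
module Submission where

open import Defs
open import Data.Nat using (ℕ; zero; suc; s≤s; _+_; _*_; _∸_; _≤_; _<_)
open import Data.Nat.Properties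
  using (≤-refl; ≤-trans; <⇒≤; +-suc; +-identityʳ; +-∸-assoc; *-suc; suc-injective)
open import Data.Bool using (true; false; not; T; _≟_)
open import Data.Bool.Properties using (T?; ¬-not)
open import Data.List using (List; []; _∷_; length; lookup; filterᵇ; map)
open import Data.List.Relation.Unary.All as All using (All; []; _∷_)
open import Data.List.Relation.Unary.Any as Any using (here)
open import Data.List.Relation.Unary.Any.Properties using (lookup-index)
open import Data.List.Relation.Unary.AllPairs using ([]; _∷_)
open import Data.List.Relation.Unary.Unique.Propositional using (Unique)
open import Data.List.Membership.Propositional using () renaming (_∈_ to _∈ᴸ_)
open import Data.List.Membership.Propositional.Properties
  using (∈-lookup; ∈-filter⁺; ∈-map⁺; ∈-++⁺ˡ; ∈-++⁺ʳ)
open import Data.Fin using (Fin; zero; suc)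
open import Data.Fin.Properties using (any?; injective⇒≤)
open import Data.Fin.Subset
open import Data.Fin.Subset.Properties
open import Data.Vec using ([]; _∷_; here; there)
open import Data.Product using (Σ; _×_; _,_; proj₁)
open import Data.Sum using (inj₁; inj₂)
open import Data.Unit using (tt)
open import Data.Empty using (⊥-elim)
open import Function using (_∘_)
open import Function.Definitions using (Injective)
open import Relation.Nullary using (¬_; yes; no)
open import Relation.Nullary.Decidable using (_×-dec_)
open import Relation.Binary.PropositionalEquality
open ≡-Reasoning

module _ {a} {A : Set a} where

  Unique⇒lookup-injective : {xs : List A} → Unique xs → Injective _≡_ _≡_ (lookup xs)
  Unique⇒lookup-injective {_ ∷ _} _ {zero} {zero} _ = refl
  Unique⇒lookup-injective {_ ∷ _} (x∉ ∷ _) {zero} {suc j} eq = ⊥-elim (All.lookup x∉ (∈-lookup j) eq)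
  Unique⇒lookup-injective {_ ∷ _} (x∉ ∷ _) {suc i} {zero} eq = ⊥-elim (All.lookup x∉ (∈-lookup i) (sym eq))
  Unique⇒lookup-injective {_ ∷ _} (_ ∷ u) {suc i} {suc j} eq = cong suc (Unique⇒lookup-injective u eq)

  Unique∧⊆⇒length≤ : {xs ys : List A} → Unique xs → (∀ {x} → x ∈ᴸ xs → x ∈ᴸ ys) →
                     length xs ≤ length ys
  Unique∧⊆⇒length≤ {xs} {ys} u xs⊆ys = injective⇒≤ position-injective
    where
    position : Fin (length xs) → Fin (length ys)
    position i = Any.index (xs⊆ys (∈-lookup i))

    position-injective : Injective _≡_ _≡_ position
    position-injective {i} {j} eq = Unique⇒lookup-injective u (begin
      lookup xs i            ≡⟨ lookup-index (xs⊆ys (∈-lookup i)) ⟩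
      lookup ys (position i) ≡⟨ cong (lookup ys) eq ⟩
      lookup ys (position j) ≡⟨ lookup-index (xs⊆ys (∈-lookup j)) ⟨
      lookup xs j            ∎)

∈-allSubsets : ∀ {n} (p : Subset n) → p ∈ᴸ allSubsets n
∈-allSubsets [] = here refl
∈-allSubsets {suc n} (outside ∷ p) = ∈-++⁺ˡ (∈-map⁺ (outside ∷_) (∈-allSubsets p))
∈-allSubsets {suc n} (inside ∷ p) =
  ∈-++⁺ʳ (map (outside ∷_) (allSubsets n)) (∈-map⁺ (inside ∷_) (∈-allSubsets p))

x∈p─q⇒x∉q : ∀ {n} (p q : Subset n) {x} → x ∈ p ─ q → x ∉ q
x∈p─q⇒x∉q (_ ∷ p) (outside ∷ q) (there x∈) (there x∈q) = x∈p─q⇒x∉q p q x∈ x∈q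
x∈p─q⇒x∉q (_ ∷ p) (inside ∷ q) (there x∈) (there x∈q) = x∈p─q⇒x∉q p q x∈ x∈q

x∈p-y⇒x≢y : ∀ {n} (p : Subset n) {x} y → x ∈ p - y → x ≢ y
x∈p-y⇒x≢y p y x∈ = x∉⁅y⁆⇒x≢y (x∈p─q⇒x∉q p ⁅ y ⁆ x∈)

x∈p⇒∣p∣≡1+∣p-x∣ : ∀ {n} (p : Subset n) {x} → x ∈ p → ∣ p ∣ ≡ suc ∣ p - x ∣
x∈p⇒∣p∣≡1+∣p-x∣ (inside ∷ p) here = cong (suc ∘ ∣_∣) (sym (p─⊥≡p p))
x∈p⇒∣p∣≡1+∣p-x∣ (inside ∷ p) (there x∈) = cong suc (x∈p⇒∣p∣≡1+∣p-x∣ p x∈)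
x∈p⇒∣p∣≡1+∣p-x∣ (outside ∷ p) (there x∈) = x∈p⇒∣p∣≡1+∣p-x∣ p x∈

x∉p-x : ∀ {n} (p : Subset n) {x} → x ∉ p - x
x∉p-x p {x} x∈p-x = x∈p-y⇒x≢y p x x∈p-x refl

x∈p∧∣p∣≡1+k⇒∣p-x∣≡k : ∀ {n k} {p : Subset n} {x} → x ∈ p → ∣ p ∣ ≡ suc k → ∣ p - x ∣ ≡ k
x∈p∧∣p∣≡1+k⇒∣p-x∣≡k {p = p} x∈p ∣p∣≡1+k = suc-injective (trans (sym (x∈p⇒∣p∣≡1+∣p-x∣ p x∈p)) ∣p∣≡1+k)

∣p∣≡1+k⇒Nonempty : ∀ {n k} (p : Subset n) → ∣ p ∣ ≡ suc k → Nonempty p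
∣p∣≡1+k⇒Nonempty (inside ∷ p) _ = zero , here
∣p∣≡1+k⇒Nonempty (outside ∷ p) eq with ∣p∣≡1+k⇒Nonempty p eq
... | x , x∈p = suc x , there x∈p

module _ {n : ℕ} {p : Subset n} where

  x∈p⇒⁅x⁆⊆p : ∀ {x} → x ∈ p → ⁅ x ⁆ ⊆ p
  x∈p⇒⁅x⁆⊆p {x} x∈p y∈⁅x⁆ = subst (_∈ p) (sym (x∈⁅y⁆⇒x≡y x y∈⁅x⁆)) x∈p

  x,y∈p⇒⁅x⁆∪⁅y⁆⊆p : ∀ {x y} → x ∈ p → y ∈ p → ⁅ x ⁆ ∪ ⁅ y ⁆ ⊆ p
  x,y∈p⇒⁅x⁆∪⁅y⁆⊆p {x} {y} x∈p y∈p z∈ with x∈p∪q⁻ ⁅ x ⁆ ⁅ y ⁆ z∈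
  ... | inj₁ z∈⁅x⁆ = x∈p⇒⁅x⁆⊆p x∈p z∈⁅x⁆
  ... | inj₂ z∈⁅y⁆ = x∈p⇒⁅x⁆⊆p y∈p z∈⁅y⁆

module _ {n : ℕ} {x y : Fin n} (x≢y : x ≢ y) where

  ⁅x⁆≢⁅y⁆ : ⁅ x ⁆ ≢ ⁅ y ⁆
  ⁅x⁆≢⁅y⁆ eq = x≢y (x∈⁅y⁆⇒x≡y y (subst (x ∈_) eq (x∈⁅x⁆ x)))

  ⁅x⁆≢⁅x⁆∪⁅y⁆ : ⁅ x ⁆ ≢ ⁅ x ⁆ ∪ ⁅ y ⁆
  ⁅x⁆≢⁅x⁆∪⁅y⁆ eq = x≢y (sym (x∈⁅y⁆⇒x≡y x (subst (y ∈_) (sym eq) (x∈p∪q⁺ (inj₂ (x∈⁅x⁆ y))))))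

2+[2t+2]≡2[1+t]+2 : ∀ t → 2 + (2 * t + 2) ≡ 2 * suc t + 2
2+[2t+2]≡2[1+t]+2 t = cong (_+ 2) (sym (*-suc 2 t))

module _ {n : ℕ} (𝓕 : Family n) where

  Packing : Subset n → ℕ → Set
  Packing U s = Σ (Fin s → Subset n) λ G → ((i : Fin s) → 𝓕 (G i) ≡ true) ×
    ((i : Fin s) → G i ⊆ U) × ((i j : Fin s) → i ≢ j → Empty (G i ∩ G j))

  Gap : Subset n → Subset n → Set
  Gap U A = 𝓕 A ≡ false × A ⊆ U

  Gaps : Subset n → ℕ → Set
  Gaps U k = Σ (List (Subset n)) λ L → Unique L × All (Gap U) L × k ≤ length L

  Escapes : Subset n → Subset n → Set
  Escapes V A = Σ (Fin n) λ z → z ∈ A × z ∉ V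

  packing-zero : ∀ {U} → Packing U 0
  packing-zero = (λ ()) , (λ ()) , (λ ()) , (λ ())

  packing-∷ : ∀ {U P s} → 𝓕 P ≡ true → P ⊆ U → Packing (U ─ P) s → Packing U (suc s)
  packing-∷ {U} {P} {s} P∈𝓕 P⊆U (G , G∈𝓕 , G⊆ , disjoint) = G′ , G′∈𝓕 , G′⊆U , disjoint′
    where
    G′ : Fin (suc s) → Subset n
    G′ zero = P
    G′ (suc i) = G i

    G′∈𝓕 : (i : Fin (suc s)) → 𝓕 (G′ i) ≡ true
    G′∈𝓕 zero = P∈𝓕
    G′∈𝓕 (suc i) = G∈𝓕 i

    G′⊆U : (i : Fin (suc s)) → G′ i ⊆ U
    G′⊆U zero = P⊆U
    G′⊆U (suc i) = ⊆-trans (G⊆ i) (p─q⊆p U P)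

    disjoint′ : (i j : Fin (suc s)) → i ≢ j → Empty (G′ i ∩ G′ j)
    disjoint′ zero zero i≢j _ = i≢j refl
    disjoint′ zero (suc j) _ (z , z∈) with x∈p∩q⁻ P (G j) z∈
    ... | z∈P , z∈Gj = x∈p─q⇒x∉q U P (G⊆ j z∈Gj) z∈P
    disjoint′ (suc i) zero _ (z , z∈) with x∈p∩q⁻ (G i) P z∈
    ... | z∈Gi , z∈P = x∈p─q⇒x∉q U P (G⊆ i z∈Gi) z∈P
    disjoint′ (suc i) (suc j) i≢j = disjoint i j (i≢j ∘ cong suc)

  packing-mono : ∀ {V U s} → V ⊆ U → Packing V s → Packing U s
  packing-mono V⊆U (G , G∈𝓕 , G⊆ , disjoint) = G , G∈𝓕 , (λ i → ⊆-trans (G⊆ i) V⊆U) , disjoint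

  ¬Packing⇒∅∉𝓕 : ∀ {U s} → ¬ Packing U (suc s) → 𝓕 ⊥ ≡ false
  ¬Packing⇒∅∉𝓕 ¬packing = ¬-not λ ∅∈𝓕 →
    ¬packing ((λ _ → ⊥) , (λ _ → ∅∈𝓕) , (λ _ → ⊥⊆) , (λ _ _ _ (_ , z∈) → ∉⊥ (proj₁ (x∈p∩q⁻ ⊥ ⊥ z∈))))

  gap-mono : ∀ {V U A} → V ⊆ U → Gap V A → Gap U A
  gap-mono V⊆U (A∉𝓕 , A⊆V) = A∉𝓕 , λ z∈A → V⊆U (A⊆V z∈A)

  gaps-mono : ∀ {V U k} → V ⊆ U → Gaps V k → Gaps U k
  gaps-mono V⊆U (L , unique , gap , k≤) = L , unique , All.map (gap-mono V⊆U) gap , k≤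

  gaps-∷∷ : ∀ {V U A B k} → V ⊆ U → Gap U A → Gap U B → A ≢ B → Escapes V A → Escapes V B →
            Gaps V k → Gaps U (2 + k)
  gaps-∷∷ {V} {U} {A} {B} V⊆U gapA gapB A≢B escA escB (L , unique , gap , k≤) =
    A ∷ B ∷ L , (A≢B ∷ fresh escA) ∷ fresh escB ∷ unique ,
    gapA ∷ gapB ∷ All.map (gap-mono V⊆U) gap , s≤s (s≤s k≤)
    where
    fresh : ∀ {C} → Escapes V C → All (C ≢_) L
    fresh (z , z∈C , z∉V) = All.map (λ (_ , D⊆V) C≡D → z∉V (D⊆V (subst (z ∈_) C≡D z∈C))) gap

  gaps-∅∷⁅x⁆ : ∀ {U s x} → ¬ Packing U (suc s) → x ∈ U → 𝓕 ⁅ x ⁆ ≡ false → Gaps U 2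
  gaps-∅∷⁅x⁆ {x = x} ¬packing x∈U ⁅x⁆∉𝓕 =
    ⊥ ∷ ⁅ x ⁆ ∷ [] , (∅≢⁅x⁆ ∷ []) ∷ [] ∷ [] ,
    (¬Packing⇒∅∉𝓕 ¬packing , ⊥⊆) ∷ (⁅x⁆∉𝓕 , x∈p⇒⁅x⁆⊆p x∈U) ∷ [] , ≤-refl
    where
    ∅≢⁅x⁆ : ⊥ ≢ ⁅ x ⁆
    ∅≢⁅x⁆ ∅≡⁅x⁆ = ∉⊥ (subst (x ∈_) (sym ∅≡⁅x⁆) (x∈⁅x⁆ x))

  ¬Packing⇒Gaps : ∀ s t (U : Subset n) → ∣ U ∣ ≡ s + t → ¬ Packing U s → Gaps U (2 * t + 2)

  ¬Packing⇒Gaps-without-singletons : ∀ s t (U : Subset n) → ∣ U ∣ ≡ suc s + t →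
    ¬ Packing U (suc s) → (∀ {x} → x ∈ U → 𝓕 ⁅ x ⁆ ≡ false) → Gaps U (2 * t + 2)

  ¬Packing⇒Gaps zero t U _ ¬packing = ⊥-elim (¬packing packing-zero)
  ¬Packing⇒Gaps (suc s) t U ∣U∣ ¬packing with any? (λ x → x ∈? U ×-dec 𝓕 ⁅ x ⁆ ≟ true)
  ... | yes (x , x∈U , ⁅x⁆∈𝓕) = gaps-mono (p─q⊆p U ⁅ x ⁆)
        (¬Packing⇒Gaps s t (U - x) (x∈p∧∣p∣≡1+k⇒∣p-x∣≡k x∈U ∣U∣)
          (¬packing ∘ packing-∷ ⁅x⁆∈𝓕 (x∈p⇒⁅x⁆⊆p x∈U)))
  ... | no no-singleton = ¬Packing⇒Gaps-without-singletons s t U ∣U∣ ¬packing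
        λ x∈U → ¬-not λ ⁅x⁆∈𝓕 → no-singleton (_ , x∈U , ⁅x⁆∈𝓕)

  ¬Packing⇒Gaps-without-singletons s zero U ∣U∣ ¬packing ⁅-⁆∉𝓕 with ∣p∣≡1+k⇒Nonempty U ∣U∣
  ... | x , x∈U = gaps-∅∷⁅x⁆ ¬packing x∈U (⁅-⁆∉𝓕 x∈U)
  ¬Packing⇒Gaps-without-singletons s (suc t) U ∣U∣ ¬packing ⁅-⁆∉𝓕
    with x , x∈U ← ∣p∣≡1+k⇒Nonempty U ∣U∣
    with ∣U-x∣ ← trans (x∈p∧∣p∣≡1+k⇒∣p-x∣≡k x∈U ∣U∣) (+-suc s t)
    with y , y∈U-x ← ∣p∣≡1+k⇒Nonempty (U - x) ∣U-x∣
    with y∈U ← p─q⊆p U ⁅ x ⁆ y∈U-x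
    with x≢y ← x∈p-y⇒x≢y U x y∈U-x ∘ sym
    with 𝓕 (⁅ x ⁆ ∪ ⁅ y ⁆) in 𝓕⁅x,y⁆
  ... | true = subst (Gaps U) (2+[2t+2]≡2[1+t]+2 t)
        (gaps-∷∷ U-x-y⊆U (⁅-⁆∉𝓕 x∈U , x∈p⇒⁅x⁆⊆p x∈U) (⁅-⁆∉𝓕 y∈U , x∈p⇒⁅x⁆⊆p y∈U) (⁅x⁆≢⁅y⁆ x≢y)
          (x , x∈⁅x⁆ x , x∉p-x U ∘ p─q⊆p (U - x) ⁅ y ⁆) (y , x∈⁅x⁆ y , x∉p-x (U - x))
          (¬Packing⇒Gaps s t (U - x - y) (x∈p∧∣p∣≡1+k⇒∣p-x∣≡k y∈U-x ∣U-x∣)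
            (¬packing ∘ packing-∷ 𝓕⁅x,y⁆ (x,y∈p⇒⁅x⁆∪⁅y⁆⊆p x∈U y∈U)
              ∘ subst (λ V → Packing V s) (p─q─r≡p─q∪r U ⁅ x ⁆ ⁅ y ⁆))))
    where
    U-x-y⊆U : U - x - y ⊆ U
    U-x-y⊆U = ⊆-trans (p─q⊆p (U - x) ⁅ y ⁆) (p─q⊆p U ⁅ x ⁆)
  ... | false = subst (Gaps U) (2+[2t+2]≡2[1+t]+2 t)
        (gaps-∷∷ (p─q⊆p U ⁅ x ⁆) (⁅-⁆∉𝓕 x∈U , x∈p⇒⁅x⁆⊆p x∈U) (𝓕⁅x,y⁆ , x,y∈p⇒⁅x⁆∪⁅y⁆⊆p x∈U y∈U)
          (⁅x⁆≢⁅x⁆∪⁅y⁆ x≢y) (x , x∈⁅x⁆ x , x∉p-x U) (x , x∈p∪q⁺ (inj₁ (x∈⁅x⁆ x)) , x∉p-x U)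
          (¬Packing⇒Gaps (suc s) t (U - x) ∣U-x∣ (¬packing ∘ packing-mono (p─q⊆p U ⁅ x ⁆))))

  Gaps⇒≤complementSize : ∀ {U k} → Gaps U k → k ≤ complementSize 𝓕
  Gaps⇒≤complementSize (L , unique , gap , k≤) = ≤-trans k≤ (Unique∧⊆⇒length≤ unique L⊆complement)
    where
    L⊆complement : ∀ {A} → A ∈ᴸ L → A ∈ᴸ filterᵇ (not ∘ 𝓕) (allSubsets n)
    L⊆complement A∈L = ∈-filter⁺ (T? ∘ not ∘ 𝓕) (∈-allSubsets _)
      (subst (T ∘ not) (sym (proj₁ (All.lookup gap A∈L))) tt)

proposition1 : (s l : ℕ) → 2 ≤ s → 1 ≤ l → l < s →
    (𝓕 : Family (2 * s ∸ l)) → νLess 𝓕 s →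
    2 * (s ∸ l) + 2 ≤ complementSize 𝓕
proposition1 s l _ _ l<s 𝓕 ν<s = Gaps⇒≤complementSize 𝓕
  (¬Packing⇒Gaps 𝓕 s (s ∸ l) ⊤ ∣⊤∣≡s+[s∸l] λ (G , G∈𝓕 , _ , disjoint) → ν<s (G , G∈𝓕 , disjoint))
  where
  ∣⊤∣≡s+[s∸l] : ∣ ⊤ {2 * s ∸ l} ∣ ≡ s + (s ∸ l)
  ∣⊤∣≡s+[s∸l] = begin
    ∣ ⊤ {2 * s ∸ l} ∣ ≡⟨ ∣⊤∣≡n (2 * s ∸ l) ⟩
    s + (s + 0) ∸ l   ≡⟨ cong (λ m → s + m ∸ l) (+-identityʳ s) ⟩
    s + s ∸ l         ≡⟨ +-∸-assoc s (<⇒≤ l<s) ⟩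
    s + (s ∸ l)       ∎
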